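{- Let $n_1,\dots,n_d\in\mathbb{N}$ and $X=[n_1]\times\cdots\times[n_d]$. Every permutation $\sigma:X\to X$ can be written as $$\sigma=\sigma_d\circ\cdots\circ\sigma_2\circ\sigma_1\circ\sigma'_2\circ\cdots\circ\sigma'_d,$$ where for each $i$, $\sigma_i$ and $\sigma'_i$ are $i$-permutations of $X$.
   Context: $[n]=\{1,\dots,n\}$. A permutation $\tau:X\to X$ is an $i$-permutation if it affects only the $i$-th coordinate, i.e. for every $x\in X$, $x$ and $\tau(x)$ agree in every coordinate other than the $i$-th. -}

module Defs where

open import Data.Nat using (ℕ; zero; suc)
open import Data.Fin using (Fin; zero; suc)
open import Data.Product using (Σ; _×_)
open import Relation.Binary.PropositionalEquality using (_≡_)
open import Relation.Nullary using (¬_)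
open import Function using (_∘_)

-- X = [n_1] × ... × [n_d], with [n] modelled as Fin n (0-based; same cardinality)
X : {d : ℕ} → (Fin d → ℕ) → Set
X {d} ns = (i : Fin d) → Fin (ns i)

_≈X_ : {d : ℕ} {ns : Fin d → ℕ} → X ns → X ns → Set
x ≈X y = ∀ i → x i ≡ y i

record Perm {d : ℕ} (ns : Fin d → ℕ) : Set where
  field
    to      : X ns → X ns
    from    : X ns → X ns
    to-cong   : ∀ {x y} → x ≈X y → to x ≈X to y
    from-cong : ∀ {x y} → x ≈X y → from x ≈X from y
    to-from : ∀ x → to (from x) ≈X x
    from-to : ∀ x → from (to x) ≈X x
open Perm public

IsIPerm : {d : ℕ} {ns : Fin d → ℕ} → Fin d → Perm ns → Set
IsIPerm {d} {ns} i τ = ∀ (x : X ns) (j : Fin d) → ¬ (j ≡ i) → to τ x j ≡ x j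

-- composeUp d f = f (d-1) ∘ ... ∘ f 1 ∘ f 0  (f 0 is applied first)
composeUp : {A : Set} (d : ℕ) → (Fin d → A → A) → A → A
composeUp zero f = λ a → a
composeUp (suc d) f = composeUp d (f ∘ suc) ∘ f zero

-- composeDown d f = f 0 ∘ f 1 ∘ ... ∘ f (d-1)  (f (d-1) is applied first)
composeDown : {A : Set} (d : ℕ) → (Fin d → A → A) → A → A
composeDown zero f = λ a → a
composeDown (suc d) f = f zero ∘ composeDown d (f ∘ suc)

{-# OPTIONS --safe #-}
-- Induction on the number of coordinates. Split X = Y × [n_d] and encode Y by [N], so that σ becomes a
-- permutation of the grid [N] × [n_d]. Joining a to a' once for every cell of the fibre {a} × [n_d] that σ
-- sends into the fibre {a'} × [n_d] gives an n_d-regular bipartite multigraph. By Hall's theorem it has a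
-- perfect matching; removing it and repeating (König) sorts the cells into n_d layers, which yields
-- σ = C ∘ R ∘ C' where C and C' only change the last coordinate (they are σ_d and σ'_d) and R permutes
-- each layer Y × {k}. By induction each layer permutation of Y is a product of coordinate permutations
-- of Y, and lifting these layer by layer gives the remaining σ_i and σ'_i.
module Submission where

open import Defs
open import Level using (0ℓ)
open import Data.Nat using (ℕ; NonZero; zero; suc; _+_; _*_; _≤_; _<_; _≤?_; _<?_; z≤n; s≤s; s≤s⁻¹)
open import Data.Nat.Properties
  using (≤-refl; ≤-reflexive; ≤-trans; ≤-<-trans; n≤1+n; n≤0⇒n≡0; ≰⇒>; 1+n≰n;
         +-suc; +-comm; +-monoʳ-≤; +-cancelʳ-≤; *-cancelʳ-≤; module ≤-Reasoning)
open import Data.Fin using (Fin; zero; suc; punchIn; punchOut; inject₁; fromℕ; combine; remQuot)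
open import Data.Fin.Properties
  using (any?; _≟_; suc-injective; punchOut-injective; injective⇒≤; punchInᵢ≢i; punchIn-punchOut;
         punchOut-punchIn; punchOut-cong; combine-remQuot; remQuot-combine; *↔×)
open import Data.Fin.Relation.Unary.Top using (view; ‵fromℕ; ‵inject₁; view-inject₁; view-fromℕ)
open import Data.Fin.Permutation
  using (Permutation′; permutation; id; flip; insert; _⟨$⟩ʳ_; _⟨$⟩ˡ_; inverseˡ; inverseʳ)
open import Data.Fin.Subset
  using (Subset; inside; outside; _∈_; _∉_; _⊆_; _∪_; _∩_; _─_; _-_; ∣_∣; ⁅_⁆; ⊤; Nonempty; Empty)
open import Data.Fin.Subset.Properties
  using (_∈?_; _⊆?_; nonempty?; anySubset?; Empty-unique; drop-∷-Empty; ∈⊤; ∣⊤∣≡n; ∣⊥∣≡0; ∣⁅x⁆∣≡1;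
         x∈⁅x⁆; x∈⁅y⁆⇒x≡y; x∈p∪q⁺; x∈p∪q⁻; x∈p∩q⁺; x∈p∩q⁻; x∈p∧x∉q⇒x∈p─q; x∈p∧x≢y⇒x∈p-y; p─q⊆p;
         p⊆q⇒∣p∣≤∣q∣; x∈p⇒∣p-x∣<∣p∣; p∩q≢∅⇒∣p─q∣<∣p∣)
open import Data.Product using (Σ; ∃; _×_; _,_; proj₁; proj₂)
open import Data.Sum using (inj₁; inj₂)
open import Data.Vec using ([]; _∷_; _++_; replicate; here; there; tabulate; lookup)
open import Data.Vec.Properties
  using (lookup⇒[]=; []=⇒lookup; lookup∘tabulate; lookup-++ˡ; lookup-++ʳ; lookup-replicate)
open import Data.Vec.Functional using (init; last)
open import Function using (_∘_; _↔_; Inverse; Injection; mk↔ₛ′)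
open import Function.Construct.Composition using (_↔-∘_)
open import Function.Construct.Symmetry using (↔-sym)
open import Function.Definitions using (Injective)
open import Function.Properties.Inverse using (↔⇒↣)
open import Relation.Binary using (Decidable; Setoid; _Preserves_⟶_)
import Relation.Binary.Reasoning.Setoid as SetoidReasoning
open import Relation.Binary.PropositionalEquality
  using (_≡_; _≢_; refl; sym; trans; cong; cong₂; subst; module ≡-Reasoning)
open import Relation.Nullary using (¬_; Dec; yes; no; does; contradiction)
open import Relation.Nullary.Decidable using (_×-dec_; ¬?; dec-true)

module _ {n : ℕ} where

  Empty⇒∣p∣≡0 : {p : Subset n} → Empty p → ∣ p ∣ ≡ 0
  Empty⇒∣p∣≡0 empty = trans (cong ∣_∣ (Empty-unique empty)) (∣⊥∣≡0 n)

  ∣p∣≡0⇒Empty : {p : Subset n} → ∣ p ∣ ≡ 0 → Empty p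
  ∣p∣≡0⇒Empty {p} ∣p∣≡0 (x , x∈p) with () ← subst (∣ p - x ∣ <_) ∣p∣≡0 (x∈p⇒∣p-x∣<∣p∣ x∈p)

  0<∣p∣⇒Nonempty : {p : Subset n} → 0 < ∣ p ∣ → Nonempty p
  0<∣p∣⇒Nonempty {p} 0<∣p∣ with nonempty? p
  ... | yes nonempty = nonempty
  ... | no empty with () ← subst (0 <_) (Empty⇒∣p∣≡0 empty) 0<∣p∣

x∈p─q⇒x∉q : ∀ {n} (p q : Subset n) {x} → x ∈ p ─ q → x ∉ q
x∈p─q⇒x∉q (_ ∷ p) (outside ∷ q) here          ()
x∈p─q⇒x∉q (_ ∷ p) (_ ∷ q)       (there x∈p─q) (there x∈q) = x∈p─q⇒x∉q p q x∈p─q x∈q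

∣p∪q∣≤∣p∣+∣q∣ : ∀ {n} (p q : Subset n) → ∣ p ∪ q ∣ ≤ ∣ p ∣ + ∣ q ∣
∣p∪q∣≤∣p∣+∣q∣ []            []            = z≤n
∣p∪q∣≤∣p∣+∣q∣ (inside ∷ p)  (inside ∷ q)  =
  s≤s (≤-trans (∣p∪q∣≤∣p∣+∣q∣ p q) (+-monoʳ-≤ ∣ p ∣ (n≤1+n ∣ q ∣)))
∣p∪q∣≤∣p∣+∣q∣ (inside ∷ p)  (outside ∷ q) = s≤s (∣p∪q∣≤∣p∣+∣q∣ p q)
∣p∪q∣≤∣p∣+∣q∣ (outside ∷ p) (inside ∷ q)  =
  subst (suc ∣ p ∪ q ∣ ≤_) (sym (+-suc ∣ p ∣ ∣ q ∣)) (s≤s (∣p∪q∣≤∣p∣+∣q∣ p q))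
∣p∪q∣≤∣p∣+∣q∣ (outside ∷ p) (outside ∷ q) = ∣p∪q∣≤∣p∣+∣q∣ p q

∣p∪q∣≡∣p∣+∣q∣ : ∀ {n} (p q : Subset n) → Empty (p ∩ q) → ∣ p ∪ q ∣ ≡ ∣ p ∣ + ∣ q ∣
∣p∪q∣≡∣p∣+∣q∣ []            []            disjoint = refl
∣p∪q∣≡∣p∣+∣q∣ (inside ∷ p)  (inside ∷ q)  disjoint = contradiction (zero , here) disjoint
∣p∪q∣≡∣p∣+∣q∣ (inside ∷ p)  (outside ∷ q) disjoint = cong suc (∣p∪q∣≡∣p∣+∣q∣ p q (drop-∷-Empty disjoint))
∣p∪q∣≡∣p∣+∣q∣ (outside ∷ p) (inside ∷ q)  disjoint =
  trans (cong suc (∣p∪q∣≡∣p∣+∣q∣ p q (drop-∷-Empty disjoint))) (sym (+-suc ∣ p ∣ ∣ q ∣))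
∣p∪q∣≡∣p∣+∣q∣ (outside ∷ p) (outside ∷ q) disjoint = ∣p∪q∣≡∣p∣+∣q∣ p q (drop-∷-Empty disjoint)

-- Hall's marriage theorem

record Graph (m n : ℕ) : Set₁ where
  field
    Edge  : Fin m → Fin n → Set
    edge? : Decidable Edge
open Graph

module _ {m n : ℕ} where

  _∖_ : Graph m n → Subset n → Graph m n
  G ∖ T = record
    { Edge  = λ x y → Edge G x y × y ∉ T
    ; edge? = λ x y → edge? G x y ×-dec ¬? (y ∈? T)
    }

  neighbours : Graph m n → Subset m → Subset n
  neighbours G S = tabulate λ y → does (any? λ x → x ∈? S ×-dec edge? G x y)

  ∈-neighbours⁺ : ∀ G {S x y} → x ∈ S → Edge G x y → y ∈ neighbours G S
  ∈-neighbours⁺ G {S} {x} {y} x∈S e =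
    lookup⇒[]= y _ (trans (lookup∘tabulate _ y) (dec-true (any? λ x → x ∈? S ×-dec edge? G x y) (x , x∈S , e)))

  ∈-neighbours⁻ : ∀ G {S y} → y ∈ neighbours G S → ∃ λ x → x ∈ S × Edge G x y
  ∈-neighbours⁻ G {S} {y} y∈N
    with any? (λ x → x ∈? S ×-dec edge? G x y) | trans (sym (lookup∘tabulate _ y)) ([]=⇒lookup y∈N)
  ... | yes witness | _ = witness

  neighbours-∪-∖ : ∀ G {T S} → neighbours G (T ∪ S) ⊆ neighbours (G ∖ neighbours G S) T ∪ neighbours G S
  neighbours-∪-∖ G {T} {S} {y} y∈N with ∈-neighbours⁻ G y∈N
  ... | x , x∈T∪S , e with x∈p∪q⁻ T S x∈T∪S | y ∈? neighbours G S
  ...   | _        | yes y∈NS = x∈p∪q⁺ (inj₂ y∈NS)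
  ...   | inj₁ x∈T | no y∉NS  = x∈p∪q⁺ (inj₁ (∈-neighbours⁺ (G ∖ neighbours G S) x∈T (e , y∉NS)))
  ...   | inj₂ x∈S | no y∉NS  = contradiction (∈-neighbours⁺ G x∈S e) y∉NS

  neighbours-∖ : ∀ G {T U} → neighbours G T ⊆ neighbours (G ∖ U) T ∪ U
  neighbours-∖ G {T} {U} {y} y∈N with ∈-neighbours⁻ G y∈N | y ∈? U
  ... | _ , _ , _   | yes y∈U = x∈p∪q⁺ (inj₂ y∈U)
  ... | x , x∈T , e | no y∉U  = x∈p∪q⁺ (inj₁ (∈-neighbours⁺ (G ∖ U) x∈T (e , y∉U)))

  HallCondition : Graph m n → Subset m → Set
  HallCondition G L = ∀ S → S ⊆ L → ∣ S ∣ ≤ ∣ neighbours G S ∣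

  record Matching (G : Graph m n) (L : Subset m) : Set where
    field
      match           : ∀ {x} → x ∈ L → Fin n
      match-edge      : ∀ {x} (x∈L : x ∈ L) → Edge G x (match x∈L)
      match-injective : ∀ {x y} (x∈L : x ∈ L) (y∈L : y ∈ L) → match x∈L ≡ match y∈L → x ≡ y
  open Matching

  emptyMatching : ∀ {G L} → Empty L → Matching G L
  emptyMatching empty = record
    { match           = λ x∈L → contradiction (_ , x∈L) empty
    ; match-edge      = λ x∈L → contradiction (_ , x∈L) empty
    ; match-injective = λ x∈L → contradiction (_ , x∈L) empty
    }

  singletonMatching : ∀ {G x y} → Edge G x y → Matching G ⁅ x ⁆
  singletonMatching {G} {x} {y} e = record
    { match           = λ _ → y
    ; match-edge      = λ x'∈⁅x⁆ → subst (λ x' → Edge G x' y) (sym (x∈⁅y⁆⇒x≡y x x'∈⁅x⁆)) e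
    ; match-injective = λ x₁∈⁅x⁆ x₂∈⁅x⁆ _ → trans (x∈⁅y⁆⇒x≡y x x₁∈⁅x⁆) (sym (x∈⁅y⁆⇒x≡y x x₂∈⁅x⁆))
    }

  glue : ∀ {G L L₁ T} (M₁ : Matching G L₁) → (∀ {x} (x∈L₁ : x ∈ L₁) → match M₁ x∈L₁ ∈ T) →
         Matching (G ∖ T) (L ─ L₁) → Matching G L
  glue {G} {L} {L₁} {T} M₁ M₁⊆T M₂ = record
    { match = glued ; match-edge = glued-edge ; match-injective = glued-injective }
    where
    glued : ∀ {x} → x ∈ L → Fin n
    glued {x} x∈L with x ∈? L₁
    ... | yes x∈L₁ = match M₁ x∈L₁
    ... | no  x∉L₁ = match M₂ (x∈p∧x∉q⇒x∈p─q x∈L x∉L₁)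

    glued-edge : ∀ {x} (x∈L : x ∈ L) → Edge G x (glued x∈L)
    glued-edge {x} x∈L with x ∈? L₁
    ... | yes x∈L₁ = match-edge M₁ x∈L₁
    ... | no  x∉L₁ = proj₁ (match-edge M₂ (x∈p∧x∉q⇒x∈p─q x∈L x∉L₁))

    glued-injective : ∀ {x y} (x∈L : x ∈ L) (y∈L : y ∈ L) → glued x∈L ≡ glued y∈L → x ≡ y
    glued-injective {x} {y} x∈L y∈L eq with x ∈? L₁ | y ∈? L₁
    ... | yes x∈L₁ | yes y∈L₁ = match-injective M₁ x∈L₁ y∈L₁ eq
    ... | no  x∉L₁ | no  y∉L₁ =
      match-injective M₂ (x∈p∧x∉q⇒x∈p─q x∈L x∉L₁) (x∈p∧x∉q⇒x∈p─q y∈L y∉L₁) eq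
    ... | yes x∈L₁ | no  y∉L₁ =
      contradiction (subst (_∈ T) eq (M₁⊆T x∈L₁)) (proj₂ (match-edge M₂ (x∈p∧x∉q⇒x∈p─q y∈L y∉L₁)))
    ... | no  x∉L₁ | yes y∈L₁ =
      contradiction (subst (_∈ T) (sym eq) (M₁⊆T y∈L₁)) (proj₂ (match-edge M₂ (x∈p∧x∉q⇒x∈p─q x∈L x∉L₁)))

  Tight : Graph m n → Subset m → Subset m → Set
  Tight G L S = S ⊆ L × Nonempty S × ∣ S ∣ < ∣ L ∣ × ∣ neighbours G S ∣ ≤ ∣ S ∣

  tight? : ∀ G L → Dec (∃ (Tight G L))
  tight? G L = anySubset? λ S → S ⊆? L ×-dec nonempty? S ×-dec ∣ S ∣ <? ∣ L ∣ ×-dec ∣ neighbours G S ∣ ≤? ∣ S ∣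

  hallCondition-∖-tight : ∀ {G L S} → HallCondition G L → S ⊆ L → ∣ neighbours G S ∣ ≤ ∣ S ∣ →
                          HallCondition (G ∖ neighbours G S) (L ─ S)
  hallCondition-∖-tight {G} {L} {S} hallL S⊆L tight T T⊆L─S = +-cancelʳ-≤ ∣ S ∣ ∣ T ∣ _ (begin
    ∣ T ∣ + ∣ S ∣                         ≡⟨ ∣p∪q∣≡∣p∣+∣q∣ T S T∩S-empty ⟨
    ∣ T ∪ S ∣                             ≤⟨ hallL (T ∪ S) T∪S⊆L ⟩
    ∣ neighbours G (T ∪ S) ∣              ≤⟨ p⊆q⇒∣p∣≤∣q∣ (neighbours-∪-∖ G) ⟩
    ∣ neighbours G' T ∪ neighbours G S ∣  ≤⟨ ∣p∪q∣≤∣p∣+∣q∣ (neighbours G' T) (neighbours G S) ⟩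
    ∣ neighbours G' T ∣ + ∣ neighbours G S ∣ ≤⟨ +-monoʳ-≤ ∣ neighbours G' T ∣ tight ⟩
    ∣ neighbours G' T ∣ + ∣ S ∣ ∎)
    where
    open ≤-Reasoning
    G' = G ∖ neighbours G S
    T∩S-empty : Empty (T ∩ S)
    T∩S-empty (x , x∈T∩S) with x∈T , x∈S ← x∈p∩q⁻ T S x∈T∩S = x∈p─q⇒x∉q L S (T⊆L─S x∈T) x∈S
    T∪S⊆L : T ∪ S ⊆ L
    T∪S⊆L x∈T∪S with x∈p∪q⁻ T S x∈T∪S
    ... | inj₁ x∈T = p─q⊆p L S (T⊆L─S x∈T)
    ... | inj₂ x∈S = S⊆L x∈S

  hallCondition-∖-⁅⁆ : ∀ {G L x} y → HallCondition G L → ¬ ∃ (Tight G L) → x ∈ L →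
                       HallCondition (G ∖ ⁅ y ⁆) (L - x)
  hallCondition-∖-⁅⁆ {G} {L} {x} y hallL noTight x∈L T T⊆L-x with nonempty? T
  ... | no empty = ≤-trans (≤-reflexive (Empty⇒∣p∣≡0 empty)) z≤n
  ... | yes nonempty = +-cancelʳ-≤ 1 ∣ T ∣ _ (begin
    ∣ T ∣ + 1                      ≡⟨ +-comm ∣ T ∣ 1 ⟩
    suc ∣ T ∣                      ≤⟨ ≰⇒> (λ N≤T → noTight (T , T⊆L , nonempty , ∣T∣<∣L∣ , N≤T)) ⟩
    ∣ neighbours G T ∣             ≤⟨ p⊆q⇒∣p∣≤∣q∣ (neighbours-∖ G) ⟩
    ∣ neighbours G' T ∪ ⁅ y ⁆ ∣     ≤⟨ ∣p∪q∣≤∣p∣+∣q∣ (neighbours G' T) ⁅ y ⁆ ⟩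
    ∣ neighbours G' T ∣ + ∣ ⁅ y ⁆ ∣ ≡⟨ cong (∣ neighbours G' T ∣ +_) (∣⁅x⁆∣≡1 y) ⟩
    ∣ neighbours G' T ∣ + 1        ∎)
    where
    open ≤-Reasoning
    G' = G ∖ ⁅ y ⁆
    T⊆L : T ⊆ L
    T⊆L x'∈T = p─q⊆p L ⁅ x ⁆ (T⊆L-x x'∈T)
    ∣T∣<∣L∣ : ∣ T ∣ < ∣ L ∣
    ∣T∣<∣L∣ = ≤-<-trans (p⊆q⇒∣p∣≤∣q∣ T⊆L-x) (x∈p⇒∣p-x∣<∣p∣ x∈L)

  someNeighbour : ∀ {G L x} → HallCondition G L → x ∈ L → ∃ (Edge G x)
  someNeighbour {G} {L} {x} hallL x∈L = edgeTo (0<∣p∣⇒Nonempty 1≤∣N⁅x⁆∣)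
    where
    ⁅x⁆⊆L : ⁅ x ⁆ ⊆ L
    ⁅x⁆⊆L x'∈⁅x⁆ = subst (_∈ L) (sym (x∈⁅y⁆⇒x≡y x x'∈⁅x⁆)) x∈L
    1≤∣N⁅x⁆∣ : 1 ≤ ∣ neighbours G ⁅ x ⁆ ∣
    1≤∣N⁅x⁆∣ = subst (_≤ ∣ neighbours G ⁅ x ⁆ ∣) (∣⁅x⁆∣≡1 x) (hallL ⁅ x ⁆ ⁅x⁆⊆L)
    edgeTo : Nonempty (neighbours G ⁅ x ⁆) → ∃ (Edge G x)
    edgeTo (y , y∈N) with x' , x'∈⁅x⁆ , e ← ∈-neighbours⁻ G y∈N =
      y , subst (λ x' → Edge G x' y) (x∈⁅y⁆⇒x≡y x x'∈⁅x⁆) e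

  -- If some nonempty proper S ⊆ L has no surplus, match S inside G and L ─ S away from neighbours G S;
  -- otherwise match any x ∈ L to any neighbour y and remove both.
  private
    hall≤ : ∀ k {G L} → ∣ L ∣ ≤ k → HallCondition G L → Matching G L
    hall≤ zero    ∣L∣≤0 _ = emptyMatching (∣p∣≡0⇒Empty (n≤0⇒n≡0 ∣L∣≤0))
    hall≤ (suc k) {G} {L} ∣L∣≤1+k hallL with tight? G L
    ... | yes (S , S⊆L , (z , z∈S) , ∣S∣<∣L∣ , tight) =
      glue M₁ (λ x∈S → ∈-neighbours⁺ G x∈S (match-edge M₁ x∈S)) M₂
      where
      M₁ : Matching G S
      M₁ = hall≤ k (s≤s⁻¹ (≤-trans ∣S∣<∣L∣ ∣L∣≤1+k))
                   (λ S' S'⊆S → hallL S' (λ x∈S' → S⊆L (S'⊆S x∈S')))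
      ∣L─S∣<∣L∣ : ∣ L ─ S ∣ < ∣ L ∣
      ∣L─S∣<∣L∣ = p∩q≢∅⇒∣p─q∣<∣p∣ L S (z , x∈p∩q⁺ (S⊆L z∈S , z∈S))
      M₂ : Matching (G ∖ neighbours G S) (L ─ S)
      M₂ = hall≤ k (s≤s⁻¹ (≤-trans ∣L─S∣<∣L∣ ∣L∣≤1+k)) (hallCondition-∖-tight hallL S⊆L tight)
    ... | no noTight with nonempty? L
    ...   | no empty = emptyMatching empty
    ...   | yes (x , x∈L) with someNeighbour hallL x∈L
    ...     | y , e = glue (singletonMatching e) (λ _ → x∈⁅x⁆ y)
                (hall≤ k (s≤s⁻¹ (≤-trans (x∈p⇒∣p-x∣<∣p∣ x∈L) ∣L∣≤1+k))
                         (hallCondition-∖-⁅⁆ y hallL noTight x∈L))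

  hall : ∀ {G L} → HallCondition G L → Matching G L
  hall {L = L} = hall≤ ∣ L ∣ ≤-refl

injective⇒∣p∣≤∣q∣ : ∀ {k l} {g : Fin k → Fin l} → Injective _≡_ _≡_ g →
                    ∀ p {q} → (∀ {x} → x ∈ p → g x ∈ q) → ∣ p ∣ ≤ ∣ q ∣
injective⇒∣p∣≤∣q∣ g-inj []            p→q = z≤n
injective⇒∣p∣≤∣q∣ g-inj (outside ∷ p) p→q = injective⇒∣p∣≤∣q∣ (suc-injective ∘ g-inj) p (p→q ∘ there)
injective⇒∣p∣≤∣q∣ {g = g} g-inj (inside ∷ p) {q} p→q =
  ≤-trans (s≤s (injective⇒∣p∣≤∣q∣ (suc-injective ∘ g-inj) p p→q-g₀)) (x∈p⇒∣p-x∣<∣p∣ (p→q here))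
  where
  p→q-g₀ : ∀ {x} → x ∈ p → g (suc x) ∈ q - g zero
  p→q-g₀ x∈p = x∈p∧x≢y⇒x∈p-y (p→q (there x∈p)) (λ eq → contradiction (g-inj eq) λ ())

injective⇒surjective : ∀ {n} {f : Fin n → Fin n} → Injective _≡_ _≡_ f → ∀ y → ∃ λ x → f x ≡ y
injective⇒surjective {suc n} {f} f-inj y with any? (λ x → f x ≟ y)
... | yes hit = hit
... | no  miss = contradiction (injective⇒≤ punchOut∘f-injective) 1+n≰n
  where
  y≢f : ∀ x → y ≢ f x
  y≢f x = miss ∘ (x ,_) ∘ sym
  punchOut∘f-injective : Injective _≡_ _≡_ (λ x → punchOut (y≢f x))
  punchOut∘f-injective {x₁} {x₂} eq = f-inj (punchOut-injective (y≢f x₁) (y≢f x₂) eq)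

injective⇒permutation : ∀ {n} {f : Fin n → Fin n} → Injective _≡_ _≡_ f → Permutation′ n
injective⇒permutation {f = f} f-inj = permutation f (proj₁ ∘ surj) (proj₂ ∘ surj) (λ x → f-inj (proj₂ (surj (f x))))
  where surj = injective⇒surjective f-inj

∣p++q∣≡∣p∣+∣q∣ : ∀ {k l} (p : Subset k) (q : Subset l) → ∣ p ++ q ∣ ≡ ∣ p ∣ + ∣ q ∣
∣p++q∣≡∣p∣+∣q∣ []            q = refl
∣p++q∣≡∣p∣+∣q∣ (inside ∷ p)  q = cong suc (∣p++q∣≡∣p∣+∣q∣ p q)
∣p++q∣≡∣p∣+∣q∣ (outside ∷ p) q = ∣p++q∣≡∣p∣+∣q∣ p q

stretch : ∀ {n} m → Subset n → Subset (n * m)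
stretch m []      = []
stretch m (s ∷ p) = replicate m s ++ stretch m p

∣stretch∣ : ∀ {n} m (p : Subset n) → ∣ stretch m p ∣ ≡ ∣ p ∣ * m
∣stretch∣ m []            = refl
∣stretch∣ m (inside ∷ p)  =
  trans (∣p++q∣≡∣p∣+∣q∣ (replicate m inside) (stretch m p)) (cong₂ _+_ (∣⊤∣≡n m) (∣stretch∣ m p))
∣stretch∣ m (outside ∷ p) =
  trans (∣p++q∣≡∣p∣+∣q∣ (replicate m outside) (stretch m p)) (cong₂ _+_ (∣⊥∣≡0 m) (∣stretch∣ m p))

lookup-stretch : ∀ {n} m (p : Subset n) a b → lookup (stretch m p) (combine a b) ≡ lookup p a
lookup-stretch m (s ∷ p) zero    b = trans (lookup-++ˡ (replicate m s) (stretch m p) b) (lookup-replicate b s)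
lookup-stretch m (s ∷ p) (suc a) b = trans (lookup-++ʳ (replicate m s) (stretch m p) (combine a b)) (lookup-stretch m p a b)

∈-stretch⁺ : ∀ {n} m {p : Subset n} {a} b → a ∈ p → combine a b ∈ stretch m p
∈-stretch⁺ m {p} {a} b a∈p = lookup⇒[]= _ _ (trans (lookup-stretch m p a b) ([]=⇒lookup a∈p))

∈-stretch⁻ : ∀ {n} m {p : Subset n} a b → combine a b ∈ stretch m p → a ∈ p
∈-stretch⁻ m {p} a b ab∈ = lookup⇒[]= _ _ (trans (sym (lookup-stretch m p a b)) ([]=⇒lookup ab∈))

-- Permutations of a grid

Grid : ℕ → ℕ → Set
Grid N m = Fin N × Fin m

module _ {N m : ℕ} (σ : Grid N m ↔ Grid N m) where
  private module σ = Inverse σ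

  fibreGraph : Graph N N
  fibreGraph = record
    { Edge  = λ a a' → ∃ λ b → proj₁ (σ.to (a , b)) ≡ a'
    ; edge? = λ a a' → any? λ b → proj₁ (σ.to (a , b)) ≟ a'
    }

  -- Double counting: with cells numbered by combine, σ maps the ∣ S ∣ * m cells over S
  -- injectively into the cells over neighbours fibreGraph S.
  fibreGraph-hallCondition : .{{NonZero m}} → HallCondition fibreGraph ⊤
  fibreGraph-hallCondition S _ = *-cancelʳ-≤ ∣ S ∣ ∣ neighbours fibreGraph S ∣ m (begin
    ∣ S ∣ * m                               ≡⟨ ∣stretch∣ m S ⟨
    ∣ stretch m S ∣                         ≤⟨ injective⇒∣p∣≤∣q∣ σ̃-injective (stretch m S) σ̃-maps ⟩
    ∣ stretch m (neighbours fibreGraph S) ∣ ≡⟨ ∣stretch∣ m (neighbours fibreGraph S) ⟩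
    ∣ neighbours fibreGraph S ∣ * m         ∎)
    where
    open ≤-Reasoning
    σ̃ : Fin (N * m) ↔ Fin (N * m)
    σ̃ = ↔-sym *↔× ↔-∘ (σ ↔-∘ *↔×)
    σ̃-injective : Injective _≡_ _≡_ (Inverse.to σ̃)
    σ̃-injective = Injection.injective (↔⇒↣ σ̃)
    σ̃-maps : ∀ {c} → c ∈ stretch m S → Inverse.to σ̃ c ∈ stretch m (neighbours fibreGraph S)
    σ̃-maps {c} c∈ = ∈-stretch⁺ m _ (∈-neighbours⁺ fibreGraph a∈S (proj₂ (remQuot {N} m c) , refl))
      where
      a∈S : proj₁ (remQuot {N} m c) ∈ S
      a∈S = ∈-stretch⁻ m _ _ (subst (_∈ stretch m S) (sym (combine-remQuot {N} m c)) c∈)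

-- A section f : Fin N → Fin (suc m) picks the cell (a , f a) of each fibre {a} × Fin (suc m);
-- punchIn (f a) numbers the remaining cells of that fibre by Fin m.
module _ {N m : ℕ} where

  MapsSection : (Grid N (suc m) → Grid N (suc m)) → Permutation′ N → (f g : Fin N → Fin (suc m)) → Set
  MapsSection τ π f g = ∀ a → τ (a , f a) ≡ (π ⟨$⟩ʳ a , g (π ⟨$⟩ʳ a))

  AvoidsSection : (Grid N (suc m) → Grid N (suc m)) → (f g : Fin N → Fin (suc m)) → Set
  AvoidsSection τ f g = ∀ a j → let (a' , b') = τ (a , punchIn (f a) j) in g a' ≢ b'

  mapsSection⇒avoidsSection : ∀ (τ : Grid N (suc m) ↔ Grid N (suc m)) {π f g} →
                              MapsSection (Inverse.to τ) π f g → AvoidsSection (Inverse.to τ) f g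
  mapsSection⇒avoidsSection τ {π} {f} {g} τ-section a j g≡ =
    punchInᵢ≢i (f a) j (trans (sym (cong proj₂ same)) (cong f (cong proj₁ same)))
    where
    a'  = proj₁ (Inverse.to τ (a , punchIn (f a) j))
    a'' = π ⟨$⟩ˡ a'
    same : (a'' , f a'') ≡ (a , punchIn (f a) j)
    same = Injection.injective (↔⇒↣ τ)
      (trans (τ-section a'') (cong₂ _,_ (inverseʳ π) (trans (cong g (inverseʳ π)) g≡)))

  mapsSection-inverse : ∀ (τ : Grid N (suc m) ↔ Grid N (suc m)) {π f g} →
                        MapsSection (Inverse.to τ) π f g → MapsSection (Inverse.from τ) (flip π) g f
  mapsSection-inverse τ {π} {f} {g} τ-section a' =
    Inverse.inverseʳ τ (sym (trans (τ-section (π ⟨$⟩ˡ a')) (cong (λ a → a , g a) (inverseʳ π))))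

  skipSection : ∀ τ f g → AvoidsSection τ f g → Grid N m → Grid N m
  skipSection τ f g avoids (a , j) = proj₁ (τ (a , punchIn (f a) j)) , punchOut (avoids a j)

  punchOut-section : ∀ (h : Fin N → Fin (suc m)) {Q a c} → Q ≡ (a , punchIn (h a) c) →
                     (h≢ : h (proj₁ Q) ≢ proj₂ Q) → (proj₁ Q , punchOut h≢) ≡ (a , c)
  punchOut-section h {a = a} refl h≢ = cong (a ,_) (trans (punchOut-cong (h a) refl) (punchOut-punchIn (h a)))

  skipSection-inverse : ∀ {τ τ' f g} (avoids : AvoidsSection τ f g) (avoids' : AvoidsSection τ' g f) →
                        (∀ p → τ' (τ p) ≡ p) → ∀ p → skipSection τ' g f avoids' (skipSection τ f g avoids p) ≡ p
  skipSection-inverse {τ} {τ'} {f} {g} avoids avoids' τ'∘τ (a , j) = punchOut-section f τ'τ≡ (avoids' a' u)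
    where
    a' = proj₁ (τ (a , punchIn (f a) j))
    u  = punchOut (avoids a j)
    τ'τ≡ : τ' (a' , punchIn (g a') u) ≡ (a , punchIn (f a) j)
    τ'τ≡ = trans (cong (λ b → τ' (a' , b)) (punchIn-punchOut (avoids a j))) (τ'∘τ (a , punchIn (f a) j))

  removeSection : ∀ (τ : Grid N (suc m) ↔ Grid N (suc m)) π f g → MapsSection (Inverse.to τ) π f g → Grid N m ↔ Grid N m
  removeSection τ π f g τ-section = mk↔ₛ′ (skipSection τ.to f g avoids) (skipSection τ.from g f avoids⁻¹)
    (skipSection-inverse {τ.from} {τ.to} avoids⁻¹ avoids τ.strictlyInverseˡ)
    (skipSection-inverse {τ.to} {τ.from} avoids avoids⁻¹ τ.strictlyInverseʳ)
    where
    module τ = Inverse τ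
    avoids : AvoidsSection τ.to f g
    avoids = mapsSection⇒avoidsSection τ {π} {f} {g} τ-section
    avoids⁻¹ : AvoidsSection τ.from g f
    avoids⁻¹ = mapsSection⇒avoidsSection (↔-sym τ) {flip π} {g} {f} (mapsSection-inverse τ {π} {f} {g} τ-section)

  removeSection-punchIn : ∀ τ π f g τ-section a j →
    let (a' , u) = Inverse.to (removeSection τ π f g τ-section) (a , j)
    in Inverse.to τ (a , punchIn (f a) j) ≡ (a' , punchIn (g a') u)
  removeSection-punchIn τ π f g τ-section a j = cong (_ ,_) (sym (punchIn-punchOut _))

-- Up to permutations inside the fibres {a} × Fin m on either side, σ preserves every layer Fin N × {k}.
record Factorisation {N m : ℕ} (σ : Grid N m ↔ Grid N m) : Set where
  field
    before     : Fin N → Permutation′ m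
    layer      : Fin m → Permutation′ N
    after      : Fin N → Permutation′ m
    factorises : ∀ a k → Inverse.to σ (a , before a ⟨$⟩ʳ k) ≡ (layer k ⟨$⟩ʳ a , after (layer k ⟨$⟩ʳ a) ⟨$⟩ʳ k)

factorisation : ∀ {N} m (σ : Grid N m ↔ Grid N m) → Factorisation σ
factorisation zero    σ = record { before = λ _ → id ; layer = λ () ; after = λ _ → id ; factorises = λ _ () }
-- A perfect matching μ of the fibre graph is a section f that σ maps onto a section g. It becomes layer
-- zero, and σ with both sections removed is factorised by induction.
factorisation {N} (suc m) σ = record
  { before     = λ a → insert zero (f a) (before a)
  ; layer      = layer′
  ; after      = λ a' → insert zero (g a') (after a')
  ; factorises = factorises′
  }
  where
  module σ = Inverse σ
  M : Matching (fibreGraph σ) ⊤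
  M = hall (fibreGraph-hallCondition σ)
  μ : Permutation′ N
  μ = injective⇒permutation (Matching.match-injective M ∈⊤ ∈⊤)
  f : Fin N → Fin (suc m)
  f a = proj₁ (Matching.match-edge M (∈⊤ {x = a}))
  g : Fin N → Fin (suc m)
  g a' = proj₂ (σ.to (μ ⟨$⟩ˡ a' , f (μ ⟨$⟩ˡ a')))
  σ-section : MapsSection σ.to μ f g
  σ-section a = cong₂ _,_ (proj₂ (Matching.match-edge M ∈⊤))
                          (cong (λ a → proj₂ (σ.to (a , f a))) (sym (inverseˡ μ)))
  open Factorisation (factorisation m (removeSection σ μ f g σ-section))
  layer′ : Fin (suc m) → Permutation′ N
  layer′ zero    = μ
  layer′ (suc k) = layer k
  factorises′ : ∀ a k → let a' = layer′ k ⟨$⟩ʳ a in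
                σ.to (a , insert zero (f a) (before a) ⟨$⟩ʳ k) ≡ (a' , insert zero (g a') (after a') ⟨$⟩ʳ k)
  factorises′ a zero    = σ-section a
  factorises′ a (suc k) = trans (removeSection-punchIn σ μ f g σ-section a (before a ⟨$⟩ʳ k))
                                (cong (λ (a' , u) → a' , punchIn (g a') u) (factorises a k))

module _ {ℓ} (S : Setoid 0ℓ ℓ) where
  open Setoid S

  composeUp-cong : ∀ {k} {f : Fin k → Carrier → Carrier} → (∀ i → f i Preserves _≈_ ⟶ _≈_) →
                   composeUp k f Preserves _≈_ ⟶ _≈_
  composeUp-cong {zero}  f-cong x≈y = x≈y
  composeUp-cong {suc k} f-cong x≈y = composeUp-cong (f-cong ∘ suc) (f-cong zero x≈y)

  composeDown-cong : ∀ {k} {f : Fin k → Carrier → Carrier} → (∀ i → f i Preserves _≈_ ⟶ _≈_) →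
                     composeDown k f Preserves _≈_ ⟶ _≈_
  composeDown-cong {zero}  f-cong x≈y = x≈y
  composeDown-cong {suc k} f-cong x≈y = f-cong zero (composeDown-cong (f-cong ∘ suc) x≈y)

snoc : ∀ {A : Set} {k} → (Fin k → A) → A → Fin (suc k) → A
snoc {k = zero}  g a zero    = a
snoc {k = suc k} g a zero    = g zero
snoc {k = suc k} g a (suc i) = snoc (g ∘ suc) a i

snoc-elim : ∀ {A : Set} {k} {g : Fin k → A} {a} (P : Fin (suc k) → A → Set) →
            (∀ j → P (inject₁ j) (g j)) → P (fromℕ k) a → ∀ i → P i (snoc g a i)
snoc-elim {k = zero}  P Pg Pa zero    = Pa
snoc-elim {k = suc k} P Pg Pa zero    = Pg zero
snoc-elim {k = suc k} P Pg Pa (suc i) = snoc-elim (P ∘ suc) (Pg ∘ suc) Pa i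

module _ {A B : Set} (F : B → A → A) where

  composeUp-snoc : ∀ k (g : Fin k → B) b x → composeUp (suc k) (F ∘ snoc g b) x ≡ F b (composeUp k (F ∘ g) x)
  composeUp-snoc zero    g b x = refl
  composeUp-snoc (suc k) g b x = composeUp-snoc k (g ∘ suc) b (F (g zero) x)

  composeDown-snoc : ∀ k (g : Fin k → B) b x → composeDown (suc k) (F ∘ snoc g b) x ≡ composeDown k (F ∘ g) (F b x)
  composeDown-snoc zero    g b x = refl
  composeDown-snoc (suc k) g b x = cong (F (g zero)) (composeDown-snoc k (g ∘ suc) b x)

  composeUp∘composeDown-snoc : ∀ k (g : Fin (suc k) → B) (h : Fin k → B) b c x →
    composeUp (suc (suc k)) (F ∘ snoc g b) (composeDown (suc k) (F ∘ snoc h c) x) ≡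
    F b (composeUp (suc k) (F ∘ g) (composeDown k (F ∘ h) (F c x)))
  composeUp∘composeDown-snoc k g h b c x = trans
    (cong (composeUp (suc (suc k)) (F ∘ snoc g b)) (composeDown-snoc k h c x))
    (composeUp-snoc (suc k) g b (composeDown k (F ∘ h) (F c x)))

X-setoid : ∀ {d} (ns : Fin d → ℕ) → Setoid 0ℓ 0ℓ
X-setoid ns = record
  { Carrier       = X ns
  ; _≈_           = _≈X_
  ; isEquivalence = record
    { refl  = λ _ → refl
    ; sym   = λ x≈y i → sym (x≈y i)
    ; trans = λ x≈y y≈z i → trans (x≈y i) (y≈z i)
    }
  }

module _ {d : ℕ} {ns : Fin d → ℕ} where
  open Setoid (X-setoid ns) public using () renaming (refl to ≈X-refl; trans to ≈X-trans)

  ≡⇒≈X : {x y : X ns} → x ≡ y → x ≈X y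
  ≡⇒≈X refl = ≈X-refl

size : ∀ {d} → (Fin d → ℕ) → ℕ
size {zero}  ns = 1
size {suc d} ns = ns zero * size (ns ∘ suc)

encode : ∀ {d} (ns : Fin d → ℕ) → X ns → Fin (size ns)
encode {zero}  ns x = zero
encode {suc d} ns x = combine (x zero) (encode (ns ∘ suc) (x ∘ suc))

decode : ∀ {d} (ns : Fin d → ℕ) → Fin (size ns) → X ns
decode {suc d} ns c zero    = proj₁ (remQuot {ns zero} (size (ns ∘ suc)) c)
decode {suc d} ns c (suc i) = decode (ns ∘ suc) (proj₂ (remQuot {ns zero} (size (ns ∘ suc)) c)) i

encode-cong : ∀ {d} (ns : Fin d → ℕ) {x y : X ns} → x ≈X y → encode ns x ≡ encode ns y
encode-cong {zero}  ns x≈y = refl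
encode-cong {suc d} ns x≈y = cong₂ combine (x≈y zero) (encode-cong (ns ∘ suc) (x≈y ∘ suc))

encode-decode : ∀ {d} (ns : Fin d → ℕ) (c : Fin (size ns)) → encode ns (decode ns c) ≡ c
encode-decode {zero}  ns zero = refl
encode-decode {suc d} ns c = begin
  combine q (encode (ns ∘ suc) (decode (ns ∘ suc) r)) ≡⟨ cong (combine q) (encode-decode (ns ∘ suc) r) ⟩
  combine q r                                          ≡⟨ combine-remQuot {ns zero} (size (ns ∘ suc)) c ⟩
  c                                                    ∎
  where
  open ≡-Reasoning
  q = proj₁ (remQuot {ns zero} (size (ns ∘ suc)) c)
  r = proj₂ (remQuot {ns zero} (size (ns ∘ suc)) c)

decode-encode : ∀ {d} (ns : Fin d → ℕ) (x : X ns) → decode ns (encode ns x) ≈X x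
decode-encode {suc d} ns x zero    = cong proj₁ (remQuot-combine {ns zero} (x zero) (encode (ns ∘ suc) (x ∘ suc)))
decode-encode {suc d} ns x (suc i) = trans
  (cong (λ c → decode (ns ∘ suc) c i) (cong proj₂ (remQuot-combine {ns zero} (x zero) (encode (ns ∘ suc) (x ∘ suc)))))
  (decode-encode (ns ∘ suc) (x ∘ suc) i)

viaEncoding : ∀ {d} {ns : Fin d → ℕ} → Permutation′ (size ns) → Perm ns
viaEncoding {ns = ns} π = record
  { to        = λ x → decode ns (π ⟨$⟩ʳ encode ns x)
  ; from      = λ x → decode ns (π ⟨$⟩ˡ encode ns x)
  ; to-cong   = λ x≈y → ≡⇒≈X (cong (λ c → decode ns (π ⟨$⟩ʳ c)) (encode-cong ns x≈y))
  ; from-cong = λ x≈y → ≡⇒≈X (cong (λ c → decode ns (π ⟨$⟩ˡ c)) (encode-cong ns x≈y))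
  ; to-from   = λ x → ≈X-trans (≡⇒≈X (cong (decode ns) (trans (cong (π ⟨$⟩ʳ_) (encode-decode ns _)) (inverseʳ π))))
                               (decode-encode ns x)
  ; from-to   = λ x → ≈X-trans (≡⇒≈X (cong (decode ns) (trans (cong (π ⟨$⟩ˡ_) (encode-decode ns _)) (inverseˡ π))))
                               (decode-encode ns x)
  }

module LastCoordinate {n : ℕ} (ns : Fin (suc n) → ℕ) where

  initX : X ns → X (init ns)
  initX x j = x (inject₁ j)

  lastX : X ns → Fin (last ns)
  lastX x = x (fromℕ n)

  infixl 25 _∷ʳ_
  _∷ʳ_ : X (init ns) → Fin (last ns) → X ns
  (y ∷ʳ b) i with view i
  ... | ‵fromℕ     = b
  ... | ‵inject₁ j = y j

  initX-∷ʳ : ∀ y b → initX (y ∷ʳ b) ≈X y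
  initX-∷ʳ y b j rewrite view-inject₁ j = refl

  lastX-∷ʳ : ∀ y b → lastX (y ∷ʳ b) ≡ b
  lastX-∷ʳ y b rewrite view-fromℕ n = refl

  ∷ʳ-cong : ∀ {y y' b b'} → y ≈X y' → b ≡ b' → y ∷ʳ b ≈X y' ∷ʳ b'
  ∷ʳ-cong y≈y' b≡b' i with view i
  ... | ‵fromℕ     = b≡b'
  ... | ‵inject₁ j = y≈y' j

  initX∷ʳlastX : ∀ x → initX x ∷ʳ lastX x ≈X x
  initX∷ʳlastX x i with view i
  ... | ‵fromℕ     = refl
  ... | ‵inject₁ j = refl

  family-cong : ∀ {F : Fin (last ns) → X (init ns) → X (init ns)} → (∀ b → F b Preserves _≈X_ ⟶ _≈X_) →
                ∀ {b b' y y'} → b ≡ b' → y ≈X y' → F b y ≈X F b' y'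
  family-cong F-cong {b} refl = F-cong b

  code : X ns → Grid (size (init ns)) (last ns)
  code x = encode (init ns) (initX x) , lastX x

  point : Grid (size (init ns)) (last ns) → X ns
  point (a , b) = decode (init ns) a ∷ʳ b

  code-cong : ∀ {x x'} → x ≈X x' → code x ≡ code x'
  code-cong x≈x' = cong₂ _,_ (encode-cong (init ns) (x≈x' ∘ inject₁)) (x≈x' (fromℕ n))

  code-point : ∀ p → code (point p) ≡ p
  code-point (a , b) = cong₂ _,_ (trans (encode-cong (init ns) (initX-∷ʳ _ b)) (encode-decode (init ns) a)) (lastX-∷ʳ _ b)

  point-code : ∀ x → point (code x) ≈X x
  point-code x = ≈X-trans (∷ʳ-cong (decode-encode (init ns) (initX x)) refl) (initX∷ʳlastX x)

  onGrid : Perm ns → Grid (size (init ns)) (last ns) ↔ Grid (size (init ns)) (last ns)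
  onGrid σ = mk↔ₛ′ (code ∘ to σ ∘ point) (code ∘ from σ ∘ point)
    (λ p → trans (code-cong (≈X-trans (to-cong σ (point-code _)) (to-from σ _))) (code-point p))
    (λ p → trans (code-cong (≈X-trans (from-cong σ (point-code _)) (from-to σ _))) (code-point p))

  modifyLast : (Fin (size (init ns)) → Fin (last ns) → Fin (last ns)) → X ns → X ns
  modifyLast h x = initX x ∷ʳ h (encode (init ns) (initX x)) (lastX x)

  modifyLast-cong : ∀ h → modifyLast h Preserves _≈X_ ⟶ _≈X_
  modifyLast-cong h x≈x' =
    ∷ʳ-cong (x≈x' ∘ inject₁) (cong₂ h (encode-cong (init ns) (x≈x' ∘ inject₁)) (x≈x' (fromℕ n)))

  modifyLast-∷ʳ : ∀ h y b → modifyLast h (y ∷ʳ b) ≈X y ∷ʳ h (encode (init ns) y) b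
  modifyLast-∷ʳ h y b = ∷ʳ-cong (initX-∷ʳ y b) (cong₂ h (encode-cong (init ns) (initX-∷ʳ y b)) (lastX-∷ʳ y b))

  alongLast : (Fin (size (init ns)) → Permutation′ (last ns)) → Perm ns
  alongLast γ = record
    { to        = modifyLast λ a → γ a ⟨$⟩ʳ_
    ; from      = modifyLast λ a → γ a ⟨$⟩ˡ_
    ; to-cong   = modifyLast-cong λ a → γ a ⟨$⟩ʳ_
    ; from-cong = modifyLast-cong λ a → γ a ⟨$⟩ˡ_
    ; to-from   = λ x → ≈X-trans (modifyLast-∷ʳ (λ a → γ a ⟨$⟩ʳ_) (initX x) _)
                                 (≈X-trans (∷ʳ-cong ≈X-refl (inverseʳ (γ (encode (init ns) (initX x))))) (initX∷ʳlastX x))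
    ; from-to   = λ x → ≈X-trans (modifyLast-∷ʳ (λ a → γ a ⟨$⟩ˡ_) (initX x) _)
                                 (≈X-trans (∷ʳ-cong ≈X-refl (inverseˡ (γ (encode (init ns) (initX x))))) (initX∷ʳlastX x))
    }

  alongLast-isIPerm : ∀ γ → IsIPerm (fromℕ n) (alongLast γ)
  alongLast-isIPerm γ x j j≢n with view j
  ... | ‵fromℕ     = contradiction refl j≢n
  ... | ‵inject₁ _ = refl

  modifyInit : (Fin (last ns) → X (init ns) → X (init ns)) → X ns → X ns
  modifyInit F x = F (lastX x) (initX x) ∷ʳ lastX x

  module _ (F : Fin (last ns) → X (init ns) → X (init ns)) (F-cong : ∀ b → F b Preserves _≈X_ ⟶ _≈X_) where

    modifyInit-cong : modifyInit F Preserves _≈X_ ⟶ _≈X_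
    modifyInit-cong x≈x' = ∷ʳ-cong (family-cong F-cong (x≈x' (fromℕ n)) (x≈x' ∘ inject₁)) (x≈x' (fromℕ n))

    modifyInit-∷ʳ : ∀ y b → modifyInit F (y ∷ʳ b) ≈X F b y ∷ʳ b
    modifyInit-∷ʳ y b = ∷ʳ-cong (family-cong F-cong (lastX-∷ʳ y b) (initX-∷ʳ y b)) (lastX-∷ʳ y b)

  layerwise : (Fin (last ns) → Perm (init ns)) → Perm ns
  layerwise G = record
    { to        = modifyInit λ b → to (G b)
    ; from      = modifyInit λ b → from (G b)
    ; to-cong   = modifyInit-cong (to ∘ G) (to-cong ∘ G)
    ; from-cong = modifyInit-cong (from ∘ G) (from-cong ∘ G)
    ; to-from   = λ x → ≈X-trans (modifyInit-∷ʳ (to ∘ G) (to-cong ∘ G) _ _)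
                                 (≈X-trans (∷ʳ-cong (to-from (G _) _) refl) (initX∷ʳlastX x))
    ; from-to   = λ x → ≈X-trans (modifyInit-∷ʳ (from ∘ G) (from-cong ∘ G) _ _)
                                 (≈X-trans (∷ʳ-cong (from-to (G _) _) refl) (initX∷ʳlastX x))
    }

  layerwise-isIPerm : ∀ G j → (∀ b → IsIPerm j (G b)) → IsIPerm (inject₁ j) (layerwise G)
  layerwise-isIPerm G j G-isIPerm x i i≢j with view i
  ... | ‵fromℕ      = refl
  ... | ‵inject₁ i' = G-isIPerm (lastX x) (initX x) i' (i≢j ∘ cong inject₁)

  alongLast∘layerwise∘alongLast : ∀ σ (F : Factorisation (onGrid σ)) → let open Factorisation F in
    ∀ x → to σ x ≈X to (alongLast after) (to (layerwise (viaEncoding ∘ layer)) (to (alongLast (flip ∘ before)) x))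
  alongLast∘layerwise∘alongLast σ F x = begin
    to σ x
      ≈⟨ to-cong σ (point-code x) ⟨
    to σ (point (a , b))
      ≈⟨ point-code _ ⟨
    point (Inverse.to (onGrid σ) (a , b))
      ≡⟨ cong (λ b → point (Inverse.to (onGrid σ) (a , b))) (inverseʳ (before a)) ⟨
    point (Inverse.to (onGrid σ) (a , before a ⟨$⟩ʳ k))
      ≡⟨ cong point (factorises a k) ⟩
    decode (init ns) a' ∷ʳ (after a' ⟨$⟩ʳ k)
      ≈⟨ ∷ʳ-cong ≈X-refl (cong (λ c → after c ⟨$⟩ʳ k) (encode-decode (init ns) a')) ⟨
    decode (init ns) a' ∷ʳ (after (encode (init ns) (decode (init ns) a')) ⟨$⟩ʳ k)
      ≈⟨ modifyLast-∷ʳ (λ c → after c ⟨$⟩ʳ_) (decode (init ns) a') k ⟨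
    to (alongLast after) (decode (init ns) a' ∷ʳ k)
      ≈⟨ to-cong (alongLast after) (modifyInit-∷ʳ (to ∘ τ) (to-cong ∘ τ) y k) ⟨
    to (alongLast after) (to (layerwise τ) (y ∷ʳ k))
      ∎
    where
    open Factorisation F
    open SetoidReasoning (X-setoid ns)
    τ  = viaEncoding ∘ layer
    y  = initX x
    a  = encode (init ns) y
    b  = lastX x
    k  = before a ⟨$⟩ˡ b
    a' = layer k ⟨$⟩ʳ a

  composeUp-layerwise : ∀ k (G : Fin k → Fin (last ns) → Perm (init ns)) y b →
    composeUp k (λ j → to (layerwise (G j))) (y ∷ʳ b) ≈X composeUp k (λ j → to (G j b)) y ∷ʳ b
  composeUp-layerwise zero    G y b = ≈X-refl
  composeUp-layerwise (suc k) G y b = ≈X-trans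
    (composeUp-cong (X-setoid ns) (λ j → to-cong (layerwise (G (suc j)))) (modifyInit-∷ʳ (to ∘ G zero) (to-cong ∘ G zero) y b))
    (composeUp-layerwise k (G ∘ suc) (to (G zero b) y) b)

  composeDown-layerwise : ∀ k (G : Fin k → Fin (last ns) → Perm (init ns)) y b →
    composeDown k (λ j → to (layerwise (G j))) (y ∷ʳ b) ≈X composeDown k (λ j → to (G j b)) y ∷ʳ b
  composeDown-layerwise zero    G y b = ≈X-refl
  composeDown-layerwise (suc k) G y b = ≈X-trans
    (to-cong (layerwise (G zero)) (composeDown-layerwise k (G ∘ suc) y b))
    (modifyInit-∷ʳ (to ∘ G zero) (to-cong ∘ G zero) _ b)

  layerwise-decomposes : ∀ {k l} (τ : Fin (last ns) → Perm (init ns))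
    (G : Fin k → Fin (last ns) → Perm (init ns)) (H : Fin l → Fin (last ns) → Perm (init ns)) →
    (∀ b y → to (τ b) y ≈X composeUp k (λ j → to (G j b)) (composeDown l (λ j → to (H j b)) y)) →
    ∀ x → to (layerwise τ) x ≈X composeUp k (λ j → to (layerwise (G j))) (composeDown l (λ j → to (layerwise (H j))) x)
  layerwise-decomposes {k} {l} τ G H τ-decomposes x = begin
    to (τ b) y ∷ʳ b
      ≈⟨ ∷ʳ-cong (τ-decomposes b y) refl ⟩
    composeUp k (λ j → to (G j b)) (composeDown l (λ j → to (H j b)) y) ∷ʳ b
      ≈⟨ composeUp-layerwise k G _ b ⟨
    composeUp k G↑ (composeDown l (λ j → to (H j b)) y ∷ʳ b)
      ≈⟨ composeUp-cong (X-setoid ns) G↑-cong (composeDown-layerwise l H y b) ⟨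
    composeUp k G↑ (composeDown l H↑ (y ∷ʳ b))
      ≈⟨ composeUp-cong (X-setoid ns) G↑-cong (composeDown-cong (X-setoid ns) H↑-cong (initX∷ʳlastX x)) ⟩
    composeUp k G↑ (composeDown l H↑ x)
      ∎
    where
    open SetoidReasoning (X-setoid ns)
    y = initX x
    b = lastX x
    G↑ = λ j → to (layerwise (G j))
    H↑ = λ j → to (layerwise (H j))
    G↑-cong : ∀ j → G↑ j Preserves _≈X_ ⟶ _≈X_
    G↑-cong j = to-cong (layerwise (G j))
    H↑-cong : ∀ j → H↑ j Preserves _≈X_ ⟶ _≈X_
    H↑-cong j = to-cong (layerwise (H j))

record Decomposition {d : ℕ} {ns : Fin (suc d) → ℕ} (σ : Perm ns) : Set where
  field
    left          : Fin (suc d) → Perm ns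
    right         : Fin d → Perm ns
    left-isIPerm  : ∀ i → IsIPerm i (left i)
    right-isIPerm : ∀ k → IsIPerm (suc k) (right k)
    decomposes    : ∀ x → to σ x ≈X composeUp (suc d) (to ∘ left) (composeDown d (to ∘ right) x)

decompose : ∀ d (ns : Fin (suc d) → ℕ) (σ : Perm ns) → Decomposition σ
decompose zero ns σ = record
  { left          = λ _ → σ
  ; right         = λ ()
  ; left-isIPerm  = λ { zero x zero 0≢0 → contradiction refl 0≢0 }
  ; right-isIPerm = λ ()
  ; decomposes    = λ x → ≈X-refl
  }
decompose (suc d) ns σ = record
  { left          = snoc (layerwise ∘ leftOf) σ-last
  ; right         = snoc (layerwise ∘ rightOf) σ'-last
  ; left-isIPerm  = snoc-elim IsIPerm
                      (λ j → layerwise-isIPerm (leftOf j) j λ b → D.left-isIPerm b j)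
                      (alongLast-isIPerm after)
  ; right-isIPerm = snoc-elim (IsIPerm ∘ suc)
                      (λ j → layerwise-isIPerm (rightOf j) (suc j) λ b → D.right-isIPerm b j)
                      (alongLast-isIPerm (flip ∘ before))
  ; decomposes    = λ x → begin
      to σ x
        ≈⟨ alongLast∘layerwise∘alongLast σ F x ⟩
      to σ-last (to (layerwise (viaEncoding ∘ layer)) (to σ'-last x))
        ≈⟨ to-cong σ-last (layerwise-decomposes (viaEncoding ∘ layer) leftOf rightOf D.decomposes (to σ'-last x)) ⟩
      to σ-last (composeUp (suc d) (to ∘ layerwise ∘ leftOf)
                  (composeDown d (to ∘ layerwise ∘ rightOf) (to σ'-last x)))
        ≡⟨ composeUp∘composeDown-snoc to d (layerwise ∘ leftOf) (layerwise ∘ rightOf) σ-last σ'-last x ⟨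
      composeUp (suc (suc d)) (to ∘ snoc (layerwise ∘ leftOf) σ-last)
        (composeDown (suc d) (to ∘ snoc (layerwise ∘ rightOf) σ'-last) x)
        ∎
  }
  where
  open LastCoordinate ns
  open SetoidReasoning (X-setoid ns)
  F = factorisation (last ns) (onGrid σ)
  open Factorisation F
  module D (b : Fin (last ns)) = Decomposition (decompose d (init ns) (viaEncoding (layer b)))
  leftOf : Fin (suc d) → Fin (last ns) → Perm (init ns)
  leftOf j b = D.left b j
  rightOf : Fin d → Fin (last ns) → Perm (init ns)
  rightOf j b = D.right b j
  σ-last σ'-last : Perm ns
  σ-last  = alongLast after
  σ'-last = alongLast (flip ∘ before)

mainTheorem4 : (d : ℕ) (ns : Fin (suc d) → ℕ) (σ : Perm ns) →
  Σ (Fin (suc d) → Perm ns) λ s → Σ (Fin d → Perm ns) λ s' →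
    ((i : Fin (suc d)) → IsIPerm i (s i)) ×
    ((k : Fin d) → IsIPerm (suc k) (s' k)) ×
    ((x : X ns) →
      to σ x ≈X composeUp (suc d) (λ i → to (s i)) (composeDown d (λ k → to (s' k)) x))
mainTheorem4 d ns σ = left , right , left-isIPerm , right-isIPerm , decomposes
  where open Decomposition (decompose d ns σ)
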